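{- (i) If $S$ is a nonsinglet family, $x\in S$ is an exit element of $S$, and $T$ denotes the family obtained from $S$ by removing $x$ (with inherited colors), then the regular insertion of $x$ into $T$ gives back $S$ (with its colors). (ii) If $S$ is a nonsinglet family and $x\notin S$ is inserted regularly into $S$ to obtain a family $S'$, then $x$ is an exit element of $S'$.
   Context: A nonsinglet family is a finite set $S$ of positive integers, $|S|\ge2$, whose elements are colored red or blue with at least one red, at least one blue, and every red larger than every blue. Its sequence form is $(a_1,\dots,a_k,b_l,\dots,b_1)$ where $b_1<\dots<b_l<a_1<\dots<a_k$ are the elements, $a_i$ red, $b_j$ blue, $k,l\ge1$; a sequence of distinct numbers is called a sequence family if it has this form for some $k,l\ge1$ (the colors are then determined by position), and a one-element sequence is a (singlet) family. Exit element: for a nonsinglet family $S$ in sequence form, $x\in S$, and any $m>\max S$, let $S'$ be the sequence obtained by inserting $m$ immediately before $x$; $x$ is an exit element of $S$ if $S'$ is not a sequence family. Regular insertion: for a nonsinglet family $S$ with highest blue $b_l$ and an integer $x\notin S$, color $x$ blue if $x<b_l$ and red if $x>b_l$, keep the colors of $S$, and take $S\cup\{x\}$ with this coloring. -}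

module Defs where

open import Data.Nat using (ℕ; zero; suc; _<_; _≤_; _<?_; _≟_)
open import Data.List using (List; []; _∷_; _++_; reverse; filter)
open import Data.List.Relation.Unary.All using (All)
open import Data.List.Relation.Unary.Linked using (Linked)
open import Data.List.Membership.Propositional using (_∈_)
open import Data.Product using (_×_; Σ; ∃; _,_)
open import Relation.Binary.PropositionalEquality using (_≡_; _≢_)
open import Relation.Nullary using (¬_; yes; no)
open import Relation.Nullary.Decidable using (¬?)

-- A colored finite set of naturals, stored canonically as
-- (reds in increasing order , blues in increasing order).
-- For a nonsinglet family: reds = a₁ < … < aₖ, blues = b₁ < … < bₗ.
Fam : Set
Fam = List ℕ × List ℕ

reds : Fam → List ℕ
reds (r , _) = r

blues : Fam → List ℕ
blues (_ , b) = b

Increasing : List ℕ → Set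
Increasing = Linked _<_

record Nonsinglet (F : Fam) : Set where
  field
    redsNonempty   : reds F ≢ []
    bluesNonempty  : blues F ≢ []
    redsIncreasing : Increasing (reds F)
    bluesIncreasing : Increasing (blues F)
    redsPositive   : All (λ a → 1 ≤ a) (reds F)
    bluesPositive  : All (λ b → 1 ≤ b) (blues F)
    bluesBelowReds : All (λ b → All (λ a → b < a) (reds F)) (blues F)

seqForm : Fam → List ℕ
seqForm (r , b) = r ++ reverse b

_∈F_ : ℕ → Fam → Set
x ∈F F = x ∈ seqForm F

-- A sequence of numbers is a sequence family if it is the sequence form
-- of some nonsinglet family (distinctness is then automatic).
IsSeqFamily : List ℕ → Set
IsSeqFamily s = ∃ λ F → Nonsinglet F × seqForm F ≡ s

insertBefore : ℕ → ℕ → List ℕ → List ℕ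
insertBefore m x [] = []
insertBefore m x (y ∷ ys) with y ≟ x
... | yes _ = m ∷ y ∷ ys
... | no _  = y ∷ insertBefore m x ys

IsExit : ℕ → Fam → Set
IsExit x F = ∀ m → All (λ y → y < m) (seqForm F) →
             ¬ IsSeqFamily (insertBefore m x (seqForm F))

remove : ℕ → Fam → Fam
remove x (r , b) = filter (λ y → ¬? (y ≟ x)) r , filter (λ y → ¬? (y ≟ x)) b

insertSorted : ℕ → List ℕ → List ℕ
insertSorted x [] = x ∷ []
insertSorted x (y ∷ ys) with x <? y
... | yes _ = x ∷ y ∷ ys
... | no _  = y ∷ insertSorted x ys

lastOr : ℕ → List ℕ → ℕ
lastOr d [] = d
lastOr d (y ∷ ys) = lastOr y ys

highestBlue : Fam → ℕ
highestBlue (_ , b) = lastOr 0 b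

regIns : ℕ → Fam → Fam
regIns x (r , b) with x <? lastOr 0 b
... | yes _ = r , insertSorted x b
... | no _  = insertSorted x r , b

module Submission where

-- In sequence form a nonsinglet family reads a₁ < … < aₖ, then bₗ > … > b₁, with
-- every blue below every red; so an ascent y < z of the sequence lies inside the
-- red part (ascent-in-reds).  Hence everything before an ascent is below y
-- (before-ascent) and the entry after it is above z or below y (after-ascent).
-- Inserting a huge m before x creates the ascent (predecessor of x) < m, which
-- these facts forbid whenever x is followed by a larger entry, preceded by a
-- smaller one, or preceded by an entry that some earlier entry exceeds.  Thus
-- every red of a family with two reds and every blue below the highest blue is
-- an exit element, while the sole red and the highest blue are not (there the
-- insertion visibly yields a family).  Part (ii) follows since a regularly
-- inserted x lands in such a position of a family (which regular insertion
-- produces); part (i) since an exit element is neither the sole red nor the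
-- highest blue, so removing it leaves a family and inserting it regularly
-- restores both its color and its place.

open import Defs
open import Data.Nat using (ℕ; suc; _≤_; _<_; _<?_; _≟_; z≤n; s≤s)
open import Data.Nat.Properties
  using (<-irrefl; <-asym; <-trans; <-≤-trans; ≤-trans; ≤-refl; <⇒≤; <⇒≢; >⇒≢; <⇒≱; ≮⇒≥; ≤∧≢⇒<)
open import Data.List using (List; []; _∷_; _++_; reverse; filter; [_])
open import Data.List.Properties
  using (reverse-++; reverse-involutive; ++-assoc; ++-cancelˡ; ∷-injective; ∷-injectiveʳ;
         filter-accept; filter-reject; filter-all)
open import Data.List.Extrema.Nat using (max; xs≤max)
open import Data.List.Relation.Unary.All as All using (All; []; _∷_)
import Data.List.Relation.Unary.All.Properties as AllP
open import Data.List.Relation.Unary.Any using (here; there)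
import Data.List.Relation.Unary.Any.Properties as AnyP
open import Data.List.Relation.Unary.Linked using ([]; [-]; _∷_)
import Data.List.Relation.Unary.Linked.Properties as LinkedP
open import Data.List.Membership.Propositional using (_∈_; _∉_)
open import Data.List.Membership.Propositional.Properties
  using (∈-++⁺ˡ; ∈-++⁺ʳ; ∈-++⁻; ∈-filter⁺)
open import Data.Product using (_×_; ∃; ∃₂; _,_)
open import Data.Sum using (_⊎_; inj₁; inj₂; [_,_]′)
open import Data.Empty using (⊥-elim)
open import Relation.Binary.PropositionalEquality
  using (_≡_; _≢_; refl; sym; trans; cong; subst; module ≡-Reasoning)
open import Relation.Nullary using (¬_; Dec; yes; no)
open import Relation.Nullary.Decidable using (¬?)

keep : (x y : ℕ) → Dec (y ≢ x)
keep x y = ¬? (y ≟ x)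

nonempty : ∀ {A : Set} {y : A} {ys} → y ∈ ys → ys ≢ []
nonempty (here _) ()
nonempty (there _) ()

below⇒∉ : ∀ {x} {P : List ℕ} → All (_< x) P → x ∉ P
below⇒∉ P<x x∈P = <-irrefl refl (All.lookup P<x x∈P)

above⇒∉ : ∀ {x} {P : List ℕ} → All (x <_) P → x ∉ P
above⇒∉ x<P x∈P = <-irrefl refl (All.lookup x<P x∈P)

∉-snoc : ∀ {A : Set} {x u : A} {P} → x ∉ P → x ≢ u → x ∉ P ++ [ u ]
∉-snoc {P = P} x∉P x≢u x∈ with ∈-++⁻ P x∈
... | inj₁ x∈P = x∉P x∈P
... | inj₂ (here x≡u) = x≢u x≡u

All-reverse⁺ : ∀ {P : ℕ → Set} {xs} → All P xs → All P (reverse xs)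
All-reverse⁺ p = All.tabulate (λ q → All.lookup p (AnyP.reverse⁻ q))

All-reverse⁻ : ∀ {P : ℕ → Set} {xs} → All P (reverse xs) → All P xs
All-reverse⁻ p = All.tabulate (λ q → All.lookup p (AnyP.reverse⁺ q))

reverse-middle : ∀ (t : List ℕ) y z Q → reverse (t ++ y ∷ z ∷ Q) ≡ reverse Q ++ z ∷ y ∷ reverse t
reverse-middle t y z Q = begin
  reverse (t ++ y ∷ z ∷ Q)               ≡⟨ reverse-++ t (y ∷ z ∷ Q) ⟩
  reverse (y ∷ z ∷ Q) ++ reverse t       ≡⟨ cong (_++ reverse t) (reverse-++ (y ∷ z ∷ []) Q) ⟩
  (reverse Q ++ z ∷ y ∷ []) ++ reverse t ≡⟨ ++-assoc (reverse Q) (z ∷ y ∷ []) (reverse t) ⟩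
  reverse Q ++ z ∷ y ∷ reverse t         ∎
  where open ≡-Reasoning

++-split : ∀ {A : Set} (xs ys P L : List A) → xs ++ ys ≡ P ++ L →
  (∃ λ t → xs ≡ P ++ t × t ++ ys ≡ L) ⊎ (∃ λ t → P ≡ xs ++ t × ys ≡ t ++ L)
++-split xs ys [] L eq = inj₁ (xs , refl , eq)
++-split [] ys (p ∷ P) L eq = inj₂ (p ∷ P , refl , eq)
++-split (x ∷ xs) ys (p ∷ P) L eq with ∷-injective eq
... | refl , eq′ with ++-split xs ys P L eq′
...   | inj₁ (t , xs≡ , rest) = inj₁ (t , cong (x ∷_) xs≡ , rest)
...   | inj₂ (t , P≡ , rest) = inj₂ (t , cong (x ∷_) P≡ , rest)

init-last : ∀ (y : ℕ) ys → ∃₂ λ c u → y ∷ ys ≡ c ++ [ u ]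
init-last y [] = [] , y , refl
init-last y (z ∷ zs) with init-last z zs
... | c , u , eq = y ∷ c , u , cong (y ∷_) eq

head-below : ∀ {z zs} → Increasing (z ∷ zs) → All (z <_) zs
head-below [-] = []
head-below (z<w ∷ inc) = LinkedP.Linked⇒All <-trans z<w inc

tail-increasing : ∀ {z zs} → Increasing (z ∷ zs) → Increasing zs
tail-increasing [-] = []
tail-increasing (_ ∷ inc) = inc

cons-increasing : ∀ {y zs} → All (y <_) zs → Increasing zs → Increasing (y ∷ zs)
cons-increasing [] _ = [-]
cons-increasing (y<z ∷ _) inc = y<z ∷ inc

suffix-increasing : ∀ c {q} → Increasing (c ++ q) → Increasing q
suffix-increasing [] inc = inc
suffix-increasing (_ ∷ c) inc = suffix-increasing c (tail-increasing inc)

snoc-increasing : ∀ xs {m} → Increasing xs → All (_< m) xs → Increasing (xs ++ [ m ])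
snoc-increasing [] _ _ = [-]
snoc-increasing (x ∷ []) _ (x<m ∷ _) = x<m ∷ [-]
snoc-increasing (x ∷ y ∷ xs) (x<y ∷ inc) (_ ∷ xs<m) = x<y ∷ snoc-increasing (y ∷ xs) inc xs<m

prefix-below : ∀ c {y q} → Increasing (c ++ y ∷ q) → All (_< y) c
prefix-below [] _ = []
prefix-below (a ∷ c) inc =
  All.lookup (head-below inc) (∈-++⁺ʳ c (here refl)) ∷ prefix-below c (tail-increasing inc)

adjacent-ascend : ∀ c {y z q} → Increasing (c ++ y ∷ z ∷ q) → y < z
adjacent-ascend c inc with suffix-increasing c inc
... | y<z ∷ _ = y<z

reverse-descends : ∀ {b} t {y z} Q → Increasing b → reverse b ≡ t ++ y ∷ z ∷ Q → z < y
reverse-descends {b} t {y} {z} Q inc eq = adjacent-ascend (reverse Q) (subst Increasing b≡ inc)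
  where
  open ≡-Reasoning
  b≡ : b ≡ reverse Q ++ z ∷ y ∷ reverse t
  b≡ = begin
    b                        ≡⟨ sym (reverse-involutive b) ⟩
    reverse (reverse b)      ≡⟨ cong reverse eq ⟩
    reverse (t ++ y ∷ z ∷ Q) ≡⟨ reverse-middle t y z Q ⟩
    reverse Q ++ z ∷ y ∷ reverse t ∎

lastOr-snoc : ∀ d xs l → lastOr d (xs ++ [ l ]) ≡ l
lastOr-snoc d [] l = refl
lastOr-snoc d (y ∷ xs) l = lastOr-snoc y xs l

last-member : ∀ ys → ys ≢ [] → lastOr 0 ys ∈ ys
last-member [] ys≢[] = ⊥-elim (ys≢[] refl)
last-member (y ∷ []) _ = here refl
last-member (y ∷ z ∷ zs) _ = there (last-member (z ∷ zs) (λ ()))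

below-last : ∀ d ys → Increasing ys → All (_≤ lastOr d ys) ys
below-last d [] _ = []
below-last d (y ∷ []) _ = ≤-refl ∷ []
below-last d (y ∷ z ∷ zs) (y<z ∷ inc) with below-last y (z ∷ zs) inc
... | z≤l ∷ rest = <⇒≤ (<-≤-trans y<z z≤l) ∷ z≤l ∷ rest

insert-splits : ∀ x ys → ∃₂ λ c d →
  insertSorted x ys ≡ c ++ x ∷ d × c ++ d ≡ ys × All (_≤ x) c
insert-splits x [] = [] , [] , refl , refl , []
insert-splits x (y ∷ ys) with x <? y
... | yes _ = [] , y ∷ ys , refl , refl , []
... | no x≮y with insert-splits x ys
...   | c , d , ins≡ , c++d≡ , c≤x = y ∷ c , d , cong (y ∷_) ins≡ , cong (y ∷_) c++d≡ , ≮⇒≥ x≮y ∷ c≤x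

insert-nonempty : ∀ x ys → insertSorted x ys ≢ []
insert-nonempty x ys with insert-splits x ys
... | c , d , ins≡ , _ = λ e → nonempty (∈-++⁺ʳ c (here refl)) (trans (sym ins≡) e)

insert-All : ∀ {P : ℕ → Set} x ys → P x → All P ys → All P (insertSorted x ys)
insert-All x [] px [] = px ∷ []
insert-All x (y ∷ ys) px (py ∷ pys) with x <? y
... | yes _ = px ∷ py ∷ pys
... | no _ = py ∷ insert-All x ys px pys

insert-increasing : ∀ x ys → Increasing ys → x ∉ ys → Increasing (insertSorted x ys)
insert-increasing x [] _ _ = [-]
insert-increasing x (y ∷ ys) inc x∉ with x <? y
... | yes x<y = x<y ∷ inc
... | no x≮y = cons-increasing (insert-All x ys y<x (head-below inc))
                               (insert-increasing x ys (tail-increasing inc) (λ q → x∉ (there q)))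
  where
  y<x : y < x
  y<x = ≤∧≢⇒< (≮⇒≥ x≮y) (λ y≡x → x∉ (here (sym y≡x)))

insert-remove : ∀ x ys → Increasing ys → x ∈ ys → insertSorted x (filter (keep x) ys) ≡ ys
insert-remove x (.x ∷ ys) inc (here refl) = begin
  insertSorted x (filter (keep x) (x ∷ ys)) ≡⟨ cong (insertSorted x) (filter-reject (keep x) (λ x≢x → x≢x refl)) ⟩
  insertSorted x (filter (keep x) ys)       ≡⟨ cong (insertSorted x) (filter-all (keep x) (All.map >⇒≢ (head-below inc))) ⟩
  insertSorted x ys                         ≡⟨ insert-at-head ys (head-below inc) ⟩
  x ∷ ys                                    ∎
  where
  open ≡-Reasoning
  insert-at-head : ∀ zs → All (x <_) zs → insertSorted x zs ≡ x ∷ zs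
  insert-at-head [] _ = refl
  insert-at-head (z ∷ zs) (x<z ∷ _) with x <? z
  ... | yes _ = refl
  ... | no x≮z = ⊥-elim (x≮z x<z)
insert-remove x (y ∷ ys) inc (there x∈ys) = begin
  insertSorted x (filter (keep x) (y ∷ ys)) ≡⟨ cong (insertSorted x) (filter-accept (keep x) (<⇒≢ y<x)) ⟩
  insertSorted x (y ∷ filter (keep x) ys)   ≡⟨ insert-past (filter (keep x) ys) ⟩
  y ∷ insertSorted x (filter (keep x) ys)   ≡⟨ cong (y ∷_) (insert-remove x ys (tail-increasing inc) x∈ys) ⟩
  y ∷ ys                                    ∎
  where
  open ≡-Reasoning
  y<x : y < x
  y<x = All.lookup (head-below inc) x∈ys
  insert-past : ∀ zs → insertSorted x (y ∷ zs) ≡ y ∷ insertSorted x zs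
  insert-past zs with x <? y
  ... | yes x<y = ⊥-elim (<-asym x<y y<x)
  ... | no _ = refl

regIns-blue : ∀ {x r b} → x < lastOr 0 b → regIns x (r , b) ≡ (r , insertSorted x b)
regIns-blue {x} {r} {b} x<l with x <? lastOr 0 b
... | yes _ = refl
... | no x≮l = ⊥-elim (x≮l x<l)

regIns-red : ∀ {x r b} → ¬ x < lastOr 0 b → regIns x (r , b) ≡ (insertSorted x r , b)
regIns-red {x} {r} {b} x≮l with x <? lastOr 0 b
... | yes x<l = ⊥-elim (x≮l x<l)
... | no _ = refl

blue<red : ∀ {r b z a} → Nonsinglet (r , b) → z ∈ b → a ∈ r → z < a
blue<red ns z∈b a∈r = All.lookup (All.lookup (Nonsinglet.bluesBelowReds ns) z∈b) a∈r

ascent-in-reds : ∀ {r b} P {y z} Q → Nonsinglet (r , b) → r ++ reverse b ≡ P ++ y ∷ z ∷ Q →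
  y < z → ∃ λ t → r ≡ P ++ y ∷ z ∷ t
ascent-in-reds {r} {b} P {y} {z} Q ns eq y<z with ++-split r (reverse b) P (y ∷ z ∷ Q) eq
... | inj₁ (_ ∷ _ ∷ t , r≡ , refl) = t , r≡
... | inj₁ ([] , _ , rb≡) =
  ⊥-elim (<-asym y<z (reverse-descends [] Q (Nonsinglet.bluesIncreasing ns) rb≡))
... | inj₂ (t , _ , rb≡) =
  ⊥-elim (<-asym y<z (reverse-descends t Q (Nonsinglet.bluesIncreasing ns) rb≡))
... | inj₁ (u ∷ [] , r≡ , rest) with ∷-injective rest
...   | refl , rb≡ = ⊥-elim (<-asym y<z (blue<red ns z∈b y∈r))
  where
  z∈b : z ∈ b
  z∈b = AnyP.reverse⁻ (subst (z ∈_) (sym rb≡) (here refl))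
  y∈r : y ∈ r
  y∈r = subst (y ∈_) (sym r≡) (∈-++⁺ʳ P (here refl))

before-ascent : ∀ P {y z} Q → IsSeqFamily (P ++ y ∷ z ∷ Q) → y < z → All (_< y) P
before-ascent P Q ((r , b) , ns , eq) y<z with ascent-in-reds P Q ns eq y<z
... | t , refl = prefix-below P (Nonsinglet.redsIncreasing ns)

after-red : ∀ {b} c {z} t {w} Q → Nonsinglet (c ++ z ∷ t , b) → t ++ reverse b ≡ w ∷ Q →
  z < w ⊎ All (w <_) (c ++ z ∷ t)
after-red c (w′ ∷ t) Q ns rest with ∷-injective rest
... | refl , _ = inj₁ (adjacent-ascend c (Nonsinglet.redsIncreasing ns))
after-red c [] Q ns rb≡ =
  inj₂ (All.tabulate (blue<red ns (AnyP.reverse⁻ (subst (_ ∈_) (sym rb≡) (here refl)))))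

after-ascent : ∀ P {y z w} Q → IsSeqFamily (P ++ y ∷ z ∷ w ∷ Q) → y < z → z < w ⊎ w < y
after-ascent P {y} {z} {w} Q ((r , b) , ns , eq) y<z with ascent-in-reds P (w ∷ Q) ns eq y<z
... | t , refl with after-red (P ++ [ y ]) t Q (subst (λ rs → Nonsinglet (rs , b)) reds≡ ns) rest
  where
  reds≡ : P ++ y ∷ z ∷ t ≡ (P ++ [ y ]) ++ z ∷ t
  reds≡ = sym (++-assoc P [ y ] (z ∷ t))
  rest : t ++ reverse b ≡ w ∷ Q
  rest = ∷-injectiveʳ (∷-injectiveʳ (++-cancelˡ P _ _ (trans (sym (++-assoc P _ (reverse b))) eq)))
...   | inj₁ z<w = inj₁ z<w
...   | inj₂ w<reds = inj₂ (All.lookup w<reds (∈-++⁺ˡ (∈-++⁺ʳ P (here refl))))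

insertBefore-at : ∀ m x P Q → x ∉ P → insertBefore m x (P ++ x ∷ Q) ≡ P ++ m ∷ x ∷ Q
insertBefore-at m x [] Q _ with x ≟ x
... | yes _ = refl
... | no x≢x = ⊥-elim (x≢x refl)
insertBefore-at m x (p ∷ P) Q x∉ with p ≟ x
... | yes p≡x = ⊥-elim (x∉ (here (sym p≡x)))
... | no _ = cong (p ∷_) (insertBefore-at m x P Q (λ q → x∉ (there q)))

exit-criterion : ∀ F P x Q → seqForm F ≡ P ++ x ∷ Q → x ∉ P →
  (∀ m → All (_< m) (P ++ x ∷ Q) → ¬ IsSeqFamily (P ++ m ∷ x ∷ Q)) → IsExit x F
exit-criterion F P x Q eq x∉P no-family m above fam =
  no-family m (subst (All (_< m)) eq above)
    (subst IsSeqFamily (trans (cong (insertBefore m x) eq) (insertBefore-at m x P Q x∉P)) fam)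

not-exit : ∀ F P x Q → seqForm F ≡ P ++ x ∷ Q → x ∉ P →
  (∀ m → All (_< m) (seqForm F) → IsSeqFamily (P ++ m ∷ x ∷ Q)) → ¬ IsExit x F
not-exit F P x Q eq x∉P family exit =
  exit m above (subst IsSeqFamily inserted≡ (family m above))
  where
  m : ℕ
  m = suc (max 0 (seqForm F))
  above : All (_< m) (seqForm F)
  above = All.map s≤s (xs≤max 0 (seqForm F))
  inserted≡ : P ++ m ∷ x ∷ Q ≡ insertBefore m x (seqForm F)
  inserted≡ = sym (trans (cong (insertBefore m x) eq) (insertBefore-at m x P Q x∉P))

-- An entry followed by a larger one is an exit element: m would precede an ascent.
exit-before-ascent : ∀ F P x y Q → seqForm F ≡ P ++ x ∷ y ∷ Q → x ∉ P → x < y → IsExit x F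
exit-before-ascent F P x y Q eq x∉P x<y = exit-criterion F P x (y ∷ Q) eq x∉P no-family
  where
  no-family : ∀ m → All (_< m) (P ++ x ∷ y ∷ Q) → ¬ IsSeqFamily (P ++ m ∷ x ∷ y ∷ Q)
  no-family m above fam = <-asym x<m (All.lookup m<x (∈-++⁺ʳ P (here refl)))
    where
    x<m = All.lookup above (∈-++⁺ʳ P (here refl))
    m<x = before-ascent (P ++ [ m ]) Q (subst IsSeqFamily (sym (++-assoc P [ m ] _)) fam) x<y

-- An entry preceded by a smaller one u is an exit element: after the ascent
-- u < m the entry x would lie strictly between u and m.
exit-after-ascent : ∀ F P u x Q → seqForm F ≡ P ++ u ∷ x ∷ Q → x ∉ P → u < x → IsExit x F
exit-after-ascent F P u x Q eq x∉P u<x =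
  exit-criterion F (P ++ [ u ]) x Q (trans eq (sym (++-assoc P [ u ] (x ∷ Q))))
    (∉-snoc x∉P (>⇒≢ u<x)) no-family
  where
  no-family : ∀ m → All (_< m) ((P ++ [ u ]) ++ x ∷ Q) → ¬ IsSeqFamily ((P ++ [ u ]) ++ m ∷ x ∷ Q)
  no-family m above fam =
    [ <-asym x<m , <-asym u<x ]′
      (after-ascent P Q (subst IsSeqFamily (++-assoc P [ u ] _) fam) (<-trans u<x x<m))
    where
    x<m = All.lookup above (∈-++⁺ʳ (P ++ [ u ]) (here refl))

-- An entry whose predecessor y is exceeded by an earlier entry a is an exit
-- element: the ascent y < m would come after a.
exit-after-dominated : ∀ F P y x Q {a} → seqForm F ≡ P ++ y ∷ x ∷ Q → x ∉ P → x ≢ y →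
  a ∈ P → y < a → IsExit x F
exit-after-dominated F P y x Q eq x∉P x≢y a∈P y<a =
  exit-criterion F (P ++ [ y ]) x Q (trans eq (sym (++-assoc P [ y ] (x ∷ Q))))
    (∉-snoc x∉P x≢y) no-family
  where
  no-family : ∀ m → All (_< m) ((P ++ [ y ]) ++ x ∷ Q) → ¬ IsSeqFamily ((P ++ [ y ]) ++ m ∷ x ∷ Q)
  no-family m above fam =
    <-asym y<a (All.lookup (before-ascent P (x ∷ Q) (subst IsSeqFamily (++-assoc P [ y ] _) fam) y<m) a∈P)
    where
    y<m = All.lookup above (∈-++⁺ˡ (∈-++⁺ʳ P (here refl)))

red-exit : ∀ c x d {b} → Nonsinglet (c ++ x ∷ d , b) → c ++ d ≢ [] → IsExit x (c ++ x ∷ d , b)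
red-exit [] x [] _ c++d≢[] = ⊥-elim (c++d≢[] refl)
red-exit [] x (y ∷ d) {b} ns _ =
  exit-before-ascent (x ∷ y ∷ d , b) [] x y (d ++ reverse b) refl (λ ()) (adjacent-ascend [] (Nonsinglet.redsIncreasing ns))
red-exit (c₀ ∷ c) x d {b} ns _ with init-last c₀ c
... | c′ , u , c≡ =
  subst (λ cs → IsExit x (cs ++ x ∷ d , b)) (sym c≡)
    (exit-after-ascent ((c′ ++ [ u ]) ++ x ∷ d , b) c′ u x (d ++ reverse b) seq≡ (below⇒∉ (AllP.++⁻ˡ c′ c<x)) (All.head (AllP.++⁻ʳ c′ c<x)))
  where
  c<x : All (_< x) (c′ ++ [ u ])
  c<x = prefix-below (c′ ++ [ u ]) (subst (λ cs → Increasing (cs ++ x ∷ d)) c≡ (Nonsinglet.redsIncreasing ns))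
  seq≡ : ((c′ ++ [ u ]) ++ x ∷ d) ++ reverse b ≡ c′ ++ u ∷ x ∷ d ++ reverse b
  seq≡ = trans (++-assoc (c′ ++ [ u ]) (x ∷ d) (reverse b)) (++-assoc c′ [ u ] (x ∷ d ++ reverse b))

blue-exit : ∀ r c x d → Nonsinglet (r , c ++ x ∷ d) → d ≢ [] → IsExit x (r , c ++ x ∷ d)
blue-exit r c x [] _ d≢[] = ⊥-elim (d≢[] refl)
blue-exit [] c x (y ∷ d) ns _ = ⊥-elim (Nonsinglet.redsNonempty ns refl)
blue-exit (a ∷ rs) c x (y ∷ d) ns _ =
  exit-after-dominated (a ∷ rs , c ++ x ∷ y ∷ d) (a ∷ rs ++ reverse d) y x (reverse c) seq≡ x∉P (<⇒≢ x<y) (here refl) y<a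
  where
  x∈b = ∈-++⁺ʳ c (here refl)
  y∈b = ∈-++⁺ʳ c (there (here refl))
  x<yd : All (x <_) (y ∷ d)
  x<yd = head-below (suffix-increasing c (Nonsinglet.bluesIncreasing ns))
  x<y = All.head x<yd
  y<a = blue<red ns y∈b (here refl)
  x∉P : x ∉ a ∷ rs ++ reverse d
  x∉P = above⇒∉ (AllP.++⁺ (All.lookup (Nonsinglet.bluesBelowReds ns) x∈b) (All-reverse⁺ (All.tail x<yd)))
  seq≡ : (a ∷ rs) ++ reverse (c ++ x ∷ y ∷ d) ≡ (a ∷ rs ++ reverse d) ++ y ∷ x ∷ reverse c
  seq≡ = trans (cong ((a ∷ rs) ++_) (reverse-middle c x y d)) (sym (++-assoc (a ∷ rs) (reverse d) _))

-- The sole red is not an exit element: inserting m before it recolors it blue.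
sole-red-not-exit : ∀ {x b} → Nonsinglet (x ∷ [] , b) → ¬ IsExit x (x ∷ [] , b)
sole-red-not-exit {x} {b} ns = not-exit (x ∷ [] , b) [] x (reverse b) refl (λ ()) family
  where
  family : ∀ m → All (_< m) (x ∷ reverse b) → IsSeqFamily (m ∷ x ∷ reverse b)
  family m (x<m ∷ rb<m) = (m ∷ [] , b ++ [ x ]) , ns′ , cong (m ∷_) (reverse-++ b [ x ])
    where
    b<x : All (_< x) b
    b<x = All.map All.head (Nonsinglet.bluesBelowReds ns)
    ns′ : Nonsinglet (m ∷ [] , b ++ [ x ])
    ns′ = record
      { redsNonempty = λ ()
      ; bluesNonempty = nonempty (∈-++⁺ʳ b (here refl))
      ; redsIncreasing = [-]
      ; bluesIncreasing = snoc-increasing b (Nonsinglet.bluesIncreasing ns) b<x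
      ; redsPositive = ≤-trans (s≤s z≤n) x<m ∷ []
      ; bluesPositive = AllP.++⁺ (Nonsinglet.bluesPositive ns) (Nonsinglet.redsPositive ns)
      ; bluesBelowReds = All.map (_∷ []) (AllP.++⁺ (All-reverse⁻ rb<m) (x<m ∷ []))
      }

-- The highest blue is not an exit element: inserting m before it adds a new top red.
highest-blue-not-exit : ∀ {r b} → Nonsinglet (r , b) → ¬ IsExit (lastOr 0 b) (r , b)
highest-blue-not-exit {r} {[]} ns = ⊥-elim (Nonsinglet.bluesNonempty ns refl)
highest-blue-not-exit {r} {b₀ ∷ bs} ns with init-last b₀ bs
... | c , x , b≡ =
  subst (λ b → ¬ IsExit (lastOr 0 b) (r , b)) (sym b≡)
    (subst (λ z → ¬ IsExit z (r , c ++ [ x ])) (sym (lastOr-snoc 0 c x))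
      (not-exit (r , c ++ [ x ]) r x (reverse c) seq≡ (above⇒∉ x<r) family))
  where
  ns′ : Nonsinglet (r , c ++ [ x ])
  ns′ = subst (λ b → Nonsinglet (r , b)) b≡ ns
  x<r : All (x <_) r
  x<r = All.lookup (Nonsinglet.bluesBelowReds ns′) (∈-++⁺ʳ c (here refl))
  seq≡ : r ++ reverse (c ++ [ x ]) ≡ r ++ x ∷ reverse c
  seq≡ = cong (r ++_) (reverse-++ c [ x ])
  family : ∀ m → All (_< m) (r ++ reverse (c ++ [ x ])) → IsSeqFamily (r ++ m ∷ x ∷ reverse c)
  family m above = (r ++ [ m ] , c ++ [ x ]) , ns″ , seq′≡
    where
    r<m = AllP.++⁻ˡ r above
    b<m = All-reverse⁻ (AllP.++⁻ʳ r above)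
    x<m = All.lookup b<m (∈-++⁺ʳ c (here refl))
    seq′≡ : (r ++ [ m ]) ++ reverse (c ++ [ x ]) ≡ r ++ m ∷ x ∷ reverse c
    seq′≡ = trans (++-assoc r [ m ] _) (cong (λ q → r ++ m ∷ q) (reverse-++ c [ x ]))
    ns″ : Nonsinglet (r ++ [ m ] , c ++ [ x ])
    ns″ = record
      { redsNonempty = nonempty (∈-++⁺ʳ r (here refl))
      ; bluesNonempty = Nonsinglet.bluesNonempty ns′
      ; redsIncreasing = snoc-increasing r (Nonsinglet.redsIncreasing ns′) r<m
      ; bluesIncreasing = Nonsinglet.bluesIncreasing ns′
      ; redsPositive = AllP.++⁺ (Nonsinglet.redsPositive ns′) (≤-trans (s≤s z≤n) x<m ∷ [])
      ; bluesPositive = Nonsinglet.bluesPositive ns′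
      ; bluesBelowReds = All.zipWith (λ (z<r , z<m) → AllP.++⁺ z<r (z<m ∷ []))
                                     (Nonsinglet.bluesBelowReds ns′ , b<m)
      }

insert-blue-nonsinglet : ∀ {r b x} → Nonsinglet (r , b) → x ∉ b → 1 ≤ x → x < lastOr 0 b →
  Nonsinglet (r , insertSorted x b)
insert-blue-nonsinglet {r} {b} {x} ns x∉b 1≤x x<l = record
  { redsNonempty = Nonsinglet.redsNonempty ns
  ; bluesNonempty = insert-nonempty x b
  ; redsIncreasing = Nonsinglet.redsIncreasing ns
  ; bluesIncreasing = insert-increasing x b (Nonsinglet.bluesIncreasing ns) x∉b
  ; redsPositive = Nonsinglet.redsPositive ns
  ; bluesPositive = insert-All x b 1≤x (Nonsinglet.bluesPositive ns)
  ; bluesBelowReds = insert-All x b x<r (Nonsinglet.bluesBelowReds ns)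
  }
  where
  x<r : All (x <_) r
  x<r = All.map (<-trans x<l)
          (All.lookup (Nonsinglet.bluesBelowReds ns) (last-member b (Nonsinglet.bluesNonempty ns)))

insert-red-nonsinglet : ∀ {r b x} → Nonsinglet (r , b) → x ∉ r → x ∉ b → 1 ≤ x → ¬ x < lastOr 0 b →
  Nonsinglet (insertSorted x r , b)
insert-red-nonsinglet {r} {b} {x} ns x∉r x∉b 1≤x x≮l = record
  { redsNonempty = insert-nonempty x r
  ; bluesNonempty = Nonsinglet.bluesNonempty ns
  ; redsIncreasing = insert-increasing x r (Nonsinglet.redsIncreasing ns) x∉r
  ; bluesIncreasing = Nonsinglet.bluesIncreasing ns
  ; redsPositive = insert-All x r 1≤x (Nonsinglet.redsPositive ns)
  ; bluesPositive = Nonsinglet.bluesPositive ns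
  ; bluesBelowReds = All.tabulate (λ z∈b → insert-All x r (z<x z∈b) (All.lookup (Nonsinglet.bluesBelowReds ns) z∈b))
  }
  where
  z<x : ∀ {z} → z ∈ b → z < x
  z<x {z} z∈b = ≤∧≢⇒< (≤-trans (All.lookup (below-last 0 b (Nonsinglet.bluesIncreasing ns)) z∈b) (≮⇒≥ x≮l))
                      (λ z≡x → x∉b (subst (_∈ b) z≡x z∈b))

-- A regularly inserted blue is not the highest blue, hence an exit element.
insert-blue-exit : ∀ {r b x} → Nonsinglet (r , b) → x ∉ r → x ∉ b → 1 ≤ x → x < lastOr 0 b →
  IsExit x (r , insertSorted x b)
insert-blue-exit {r} {b} {x} ns x∉r x∉b 1≤x x<l with insert-splits x b
... | c , d , ins≡ , c++d≡b , c≤x =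
  subst (λ bs → IsExit x (r , bs)) (sym ins≡)
    (blue-exit r c x d (subst (λ bs → Nonsinglet (r , bs)) ins≡ (insert-blue-nonsinglet ns x∉b 1≤x x<l)) d≢[])
  where
  d≢[] : d ≢ []
  d≢[] with ∈-++⁻ c (subst (lastOr 0 b ∈_) (sym c++d≡b) (last-member b (Nonsinglet.bluesNonempty ns)))
  ... | inj₁ l∈c = ⊥-elim (<⇒≱ x<l (All.lookup c≤x l∈c))
  ... | inj₂ l∈d = nonempty l∈d

-- A regularly inserted red joins at least one other red, hence is an exit element.
insert-red-exit : ∀ {r b x} → Nonsinglet (r , b) → x ∉ r → x ∉ b → 1 ≤ x → ¬ x < lastOr 0 b →
  IsExit x (insertSorted x r , b)
insert-red-exit {r} {b} {x} ns x∉r x∉b 1≤x x≮l with insert-splits x r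
... | c , d , ins≡ , c++d≡r , _ =
  subst (λ rs → IsExit x (rs , b)) (sym ins≡)
    (red-exit c x d (subst (λ rs → Nonsinglet (rs , b)) ins≡ (insert-red-nonsinglet ns x∉r x∉b 1≤x x≮l))
      (λ c++d≡[] → Nonsinglet.redsNonempty ns (trans (sym c++d≡r) c++d≡[])))

∉F-split : ∀ {x r b} → ¬ (x ∈F (r , b)) → x ∉ r × x ∉ b
∉F-split {r = r} x∉S = (λ x∈r → x∉S (∈-++⁺ˡ x∈r)) , (λ x∈b → x∉S (∈-++⁺ʳ r (AnyP.reverse⁺ x∈b)))

regIns-exit : (S : Fam) (x : ℕ) → Nonsinglet S → ¬ (x ∈F S) → 1 ≤ x → IsExit x (regIns x S)
regIns-exit (r , b) x ns x∉S 1≤x with x <? lastOr 0 b | ∉F-split {x} {r} {b} x∉S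
... | yes x<l | x∉r , x∉b = insert-blue-exit ns x∉r x∉b 1≤x x<l
... | no x≮l | x∉r , x∉b = insert-red-exit ns x∉r x∉b 1≤x x≮l

remove-nonsinglet : ∀ {r b} x → Nonsinglet (r , b) →
  filter (keep x) r ≢ [] → filter (keep x) b ≢ [] → Nonsinglet (remove x (r , b))
remove-nonsinglet x ns r′≢[] b′≢[] = record
  { redsNonempty = r′≢[]
  ; bluesNonempty = b′≢[]
  ; redsIncreasing = LinkedP.filter⁺ (keep x) <-trans (Nonsinglet.redsIncreasing ns)
  ; bluesIncreasing = LinkedP.filter⁺ (keep x) <-trans (Nonsinglet.bluesIncreasing ns)
  ; redsPositive = AllP.filter⁺ (keep x) (Nonsinglet.redsPositive ns)
  ; bluesPositive = AllP.filter⁺ (keep x) (Nonsinglet.bluesPositive ns)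
  ; bluesBelowReds = AllP.filter⁺ (keep x) (All.map (AllP.filter⁺ (keep x)) (Nonsinglet.bluesBelowReds ns))
  }

filter-nonempty : ∀ {x y ys} → y ∈ ys → y ≢ x → filter (keep x) ys ≢ []
filter-nonempty y∈ys y≢x = nonempty (∈-filter⁺ (keep _) y∈ys y≢x)

other-member : ∀ {x} ys → Increasing ys → x ∈ ys → ys ≢ x ∷ [] → ∃ λ y → y ∈ ys × y ≢ x
other-member {x} (y ∷ ys) inc x∈ ys≢[x] with y ≟ x
... | no y≢x = y , here refl , y≢x
... | yes refl with ys
...   | [] = ⊥-elim (ys≢[x] refl)
...   | z ∷ zs = z , there (here refl) , >⇒≢ (All.head (head-below inc))

red-removal : ∀ {r b x} → Nonsinglet (r , b) → x ∈ r → filter (keep x) r ≢ [] →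
  Nonsinglet (remove x (r , b)) × regIns x (remove x (r , b)) ≡ (r , b)
red-removal {r} {b} {x} ns x∈r r′≢[] =
  remove-nonsinglet x ns r′≢[] (subst (_≢ []) (sym b′≡b) (Nonsinglet.bluesNonempty ns)) , restored
  where
  open ≡-Reasoning
  b′≡b : filter (keep x) b ≡ b
  b′≡b = filter-all (keep x) (All.tabulate (λ z∈b → <⇒≢ (blue<red ns z∈b x∈r)))
  x≮l : ¬ x < lastOr 0 b
  x≮l = <-asym (blue<red ns (last-member b (Nonsinglet.bluesNonempty ns)) x∈r)
  restored : regIns x (filter (keep x) r , filter (keep x) b) ≡ (r , b)
  restored = begin
    regIns x (filter (keep x) r , filter (keep x) b) ≡⟨ cong (λ bs → regIns x (filter (keep x) r , bs)) b′≡b ⟩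
    regIns x (filter (keep x) r , b)                 ≡⟨ regIns-red x≮l ⟩
    (insertSorted x (filter (keep x) r) , b)         ≡⟨ cong (_, b) (insert-remove x r (Nonsinglet.redsIncreasing ns) x∈r) ⟩
    (r , b)                                          ∎

blue-removal : ∀ {r b x} → Nonsinglet (r , b) → x ∈ b → x < lastOr 0 b →
  Nonsinglet (remove x (r , b)) × regIns x (remove x (r , b)) ≡ (r , b)
blue-removal {r} {b} {x} ns x∈b x<l =
  remove-nonsinglet x ns (subst (_≢ []) (sym r′≡r) (Nonsinglet.redsNonempty ns)) (nonempty l∈b′) , restored
  where
  open ≡-Reasoning
  r′≡r : filter (keep x) r ≡ r
  r′≡r = filter-all (keep x) (All.map >⇒≢ (All.lookup (Nonsinglet.bluesBelowReds ns) x∈b))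
  l∈b′ : lastOr 0 b ∈ filter (keep x) b
  l∈b′ = ∈-filter⁺ (keep x) (last-member b (Nonsinglet.bluesNonempty ns)) (>⇒≢ x<l)
  x<l′ : x < lastOr 0 (filter (keep x) b)
  x<l′ = <-≤-trans x<l (All.lookup (below-last 0 _ (LinkedP.filter⁺ (keep x) <-trans (Nonsinglet.bluesIncreasing ns))) l∈b′)
  restored : regIns x (filter (keep x) r , filter (keep x) b) ≡ (r , b)
  restored = begin
    regIns x (filter (keep x) r , filter (keep x) b) ≡⟨ cong (λ rs → regIns x (rs , filter (keep x) b)) r′≡r ⟩
    regIns x (r , filter (keep x) b)                 ≡⟨ regIns-blue x<l′ ⟩
    (r , insertSorted x (filter (keep x) b))         ≡⟨ cong (r ,_) (insert-remove x b (Nonsinglet.bluesIncreasing ns) x∈b) ⟩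
    (r , b)                                          ∎

-- Part (i): an exit element is neither the sole red nor the highest blue, so
-- removing it and inserting it regularly gives back the family.
exit-removal : (S : Fam) (x : ℕ) → Nonsinglet S → x ∈F S → IsExit x S →
  Nonsinglet (remove x S) × regIns x (remove x S) ≡ S
exit-removal (r , b) x ns x∈S exit with ∈-++⁻ r x∈S
... | inj₁ x∈r with other-member r (Nonsinglet.redsIncreasing ns) x∈r not-sole
  where
  not-sole : r ≢ x ∷ []
  not-sole refl = sole-red-not-exit ns exit
...   | y , y∈r , y≢x = red-removal ns x∈r (filter-nonempty y∈r y≢x)
exit-removal (r , b) x ns x∈S exit | inj₂ x∈rb = blue-removal ns x∈b x<l
  where
  x∈b = AnyP.reverse⁻ x∈rb
  x<l : x < lastOr 0 b
  x<l = ≤∧≢⇒< (All.lookup (below-last 0 b (Nonsinglet.bluesIncreasing ns)) x∈b)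
              (λ x≡l → highest-blue-not-exit ns (subst (λ z → IsExit z (r , b)) x≡l exit))

mainTheorem5 :
    ((S : Fam) (x : ℕ) → Nonsinglet S → x ∈F S → IsExit x S →
      Nonsinglet (remove x S) × regIns x (remove x S) ≡ S)
    ×
    ((S : Fam) (x : ℕ) → Nonsinglet S → ¬ (x ∈F S) → 1 ≤ x →
      IsExit x (regIns x S))
mainTheorem5 = exit-removal , regIns-exit
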